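{- Let $R$ be a directed graph with vertex set $T$ and let $H$ be a directed graph with $T\subseteq V(H)$ that is an inclusion-minimal solution to $R$. Let $s,t\in T$ and let $P=(s=p_1,\ldots,p_r=t)$ be a $T$-avoiding directed path in $H$ from $s$ to $t$. If $v$ is a vertex in $V(P)\setminus I_P$, then the out-degree of $v$ in $H$ is at most $2$. Moreover, if $u$ is an out-neighbor of $v$ not on $P$, then there is a $P$-avoiding directed path in $H$ from $u$ to some vertex $v'\in V(P)$ with $v'<_P v$.
   Context: $H$ is a solution to $R$ if for every arc $st\in A(R)$ there is a directed path from $s$ to $t$ in $H$; it is an inclusion-minimal solution if moreover for every arc $e\in A(H)$, $H-e$ is not a solution. For a vertex set $W$, a directed path $Q$ is $W$-avoiding if none of its internal vertices lies in $W$; $P$-avoiding means $V(P)$-avoiding. A vertex $u\in V(P)$ is important with respect to $P$ if there is a $P$-avoiding directed path in $H$ from some terminal not on $P$ to $u$, or from $u$ to some terminal not on $P$; $I_P$ is the set of such vertices. For $x,y\in V(P)$, $x<_P y$ means $x$ appears strictly before $y$ on $P$. -}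

module Defs where

open import Data.Nat using (ℕ)
open import Data.Bool using (Bool; true; false; _∧_; if_then_else_; T?)
open import Data.Fin as Fin using (Fin)
open import Data.Fin.Properties using (_≟_)
open import Data.List using (List; []; _∷_; length; filter; lookup; allFin)
open import Data.List.Membership.Propositional using (_∈_; _∉_)
open import Data.List.Relation.Unary.All using (All)
open import Data.List.Relation.Unary.Unique.Propositional using (Unique)
open import Data.Product using (Σ; _×_; ∃; ∃-syntax)
open import Data.Sum using (_⊎_)
open import Relation.Nullary using (¬_; ⌊_⌋)
open import Relation.Binary.PropositionalEquality using (_≡_)

Digraph : ℕ → Set
Digraph n = Fin n → Fin n → Bool

VSet : ℕ → Set
VSet n = Fin n → Bool

module _ {n : ℕ} where

  data Walk (E : Digraph n) : Fin n → Fin n → Set where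
    stop : (x : Fin n) → Walk E x x
    step : ∀ {x y z} → E x y ≡ true → Walk E y z → Walk E x z

  verts : ∀ {E x y} → Walk E x y → List (Fin n)
  verts (stop x) = x ∷ []
  verts (step {x} _ w) = x ∷ verts w

  vertsButLast : ∀ {E x y} → Walk E x y → List (Fin n)
  vertsButLast (stop _) = []
  vertsButLast (step {x} _ w) = x ∷ vertsButLast w

  inner : ∀ {E x y} → Walk E x y → List (Fin n)
  inner (stop _) = []
  inner (step _ w) = vertsButLast w

  IsPath : ∀ {E x y} → Walk E x y → Set
  IsPath w = Unique (verts w)

  DPath : Digraph n → Fin n → Fin n → Set
  DPath E x y = Σ (Walk E x y) IsPath

  Avoiding : ∀ {E x y} → List (Fin n) → Walk E x y → Set
  Avoiding W Q = All (λ z → z ∉ W) (inner Q)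

  Solution : Digraph n → Digraph n → Set
  Solution H R = ∀ s t → R s t ≡ true → DPath H s t

  removeArc : Digraph n → Fin n → Fin n → Digraph n
  removeArc H a b x y = if ⌊ x ≟ a ⌋ ∧ ⌊ y ≟ b ⌋ then false else H x y

  MinimalSolution : Digraph n → Digraph n → Set
  MinimalSolution H R =
    Solution H R × (∀ a b → H a b ≡ true → ¬ Solution (removeArc H a b) R)

  outdeg : Digraph n → Fin n → ℕ
  outdeg H v = length (filter (λ u → T? (H v u)) (allFin n))

  Before : List (Fin n) → Fin n → Fin n → Set
  Before l x y = Σ (Fin (length l)) λ i → Σ (Fin (length l)) λ j →
    i Fin.< j × lookup l i ≡ x × lookup l j ≡ y

  Important : (H : Digraph n) (Term : VSet n) {s t : Fin n} →
              Walk H s t → Fin n → Set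
  Important H Term P u =
    u ∈ verts P ×
    ∃[ w ] (Term w ≡ true × w ∉ verts P ×
      ((Σ (DPath H w u) λ Q → Avoiding (verts P) (Σ.proj₁ Q))
       ⊎ (Σ (DPath H u w) λ Q → Avoiding (verts P) (Σ.proj₁ Q))))

module Submission where

-- For an out-neighbour u of v, either u is the successor of v on P, or u is a
-- "detour" neighbour.  In the second case minimality of H yields a requirement
-- ab that is broken in H − vu; a path from a to b in H must therefore use vu,
-- and its part after u must re-enter P (otherwise v would be important) at a
-- vertex z strictly before v (otherwise following P from v to z would repair
-- the requirement without vu).  If u and u′ were
-- two distinct detour neighbours, with re-entry points z′ ≤ z, the requirement
-- broken for u could be rerouted via v → u′ ⇝ z′ ⇝ z (along P) ⇝ b avoiding vu;
-- so there is at most one detour neighbour, and at most one successor, hence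
-- out-degree at most 2.

open import Defs
open import Data.Nat using (ℕ; zero; suc; _≤_; _<_; z≤n; s≤s)
open import Data.Nat.Properties using (<⇒≤)
open import Data.Bool using (true; false; T; T?)
open import Data.Bool.Properties using (T-≡) renaming (_≟_ to _≟ᵇ_)
open import Data.Fin using (Fin) renaming (zero to fzero; suc to fsuc)
open import Data.Fin.Properties using (_≟_; injective⇒≤; any?; all?; ¬∀⟶∃¬)
open import Data.List using (List; []; _∷_; length; lookup; allFin)
open import Data.List.Membership.Propositional using (_∈_; _∉_)
open import Data.List.Membership.Propositional.Properties using (∈-lookup)
import Data.List.Membership.DecPropositional as DecMembership
open import Data.List.Relation.Binary.Subset.Propositional using (_⊆_)
open import Data.List.Relation.Unary.All as All using (All; []; _∷_)
open import Data.List.Relation.Unary.All.Properties using (all-filter)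
open import Data.List.Relation.Unary.All.Properties.Core using (¬Any⇒All¬; All¬⇒¬Any)
open import Data.List.Relation.Unary.Any using (here; there; index)
open import Data.List.Relation.Unary.Any.Properties using (lookup-index)
open import Data.List.Relation.Unary.AllPairs using ([]; _∷_)
open import Data.List.Relation.Unary.Unique.Propositional using (Unique)
open import Data.List.Relation.Unary.Unique.Propositional.Properties using (filter⁺; allFin⁺)
open import Data.Product using (Σ; _×_; _,_; ∃-syntax; proj₁; proj₂)
open import Data.Sum using (_⊎_; inj₁; inj₂)
open import Data.Unit using (⊤; tt)
open import Data.Empty using (⊥; ⊥-elim)
open import Function using (Equivalence)
open import Relation.Nullary using (¬_; Dec; yes; no)
open import Relation.Nullary.Decidable using (_×-dec_; _→-dec_; map′)
open import Relation.Binary.PropositionalEquality using (_≡_; _≢_; refl; sym; subst)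

module _ {n : ℕ} where

  open DecMembership (_≟_ {n}) using (_∈?_)

  private variable
    E : Digraph n
    a b p q s t x y z : Fin n

  infixr 5 _++ʷ_

  _++ʷ_ : Walk E x y → Walk E y z → Walk E x z
  stop _   ++ʷ w′ = w′
  step e w ++ʷ w′ = step e (w ++ʷ w′)

  last∈ : (w : Walk E x y) → y ∈ verts w
  last∈ (stop _)   = here refl
  last∈ (step _ w) = there (last∈ w)

  All-vertsButLast : ∀ {P : Fin n → Set} (w : Walk E x y) →
    All P (verts w) → All P (vertsButLast w)
  All-vertsButLast (stop _)   _        = []
  All-vertsButLast (step _ w) (p ∷ ps) = p ∷ All-vertsButLast w ps

  All-inner : ∀ {P : Fin n → Set} (w : Walk E x y) →
    All P (vertsButLast w) → All P (inner w)
  All-inner (stop _)   _        = []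
  All-inner (step _ w) (_ ∷ ps) = ps

  steps : Walk E x y → ℕ
  steps (stop _)   = zero
  steps (step _ w) = suc (steps w)

  length-verts : (w : Walk E x y) → length (verts w) ≡ suc (steps w)
  length-verts (stop _)   = refl
  length-verts (step _ w) rewrite length-verts w = refl

  suffixFrom : (w : Walk E y z) → x ∈ verts w → Walk E x z
  suffixFrom (stop _)   (here refl) = stop _
  suffixFrom (step e w) (here refl) = step e w
  suffixFrom (step e w) (there x∈w) = suffixFrom w x∈w

  suffixFrom-unique : (w : Walk E y z) (x∈w : x ∈ verts w) →
    Unique (verts w) → Unique (verts (suffixFrom w x∈w))
  suffixFrom-unique (stop _)   (here refl) u       = u
  suffixFrom-unique (step e w) (here refl) u       = u
  suffixFrom-unique (step e w) (there x∈w) (_ ∷ u) = suffixFrom-unique w x∈w u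

  shorten : Walk E x y → DPath E x y
  shorten (stop x) = stop x , ([] ∷ [])
  shorten (step {x} e w) with shorten w
  ... | p , p-unique with x ∈? verts p
  ...   | yes x∈p = suffixFrom p x∈p , suffixFrom-unique p x∈p p-unique
  ...   | no  x∉p = step e p , (¬Any⇒All¬ (verts p) x∉p ∷ p-unique)

  lookup-injective : {xs : List (Fin n)} → Unique xs →
    ∀ {i j} → lookup xs i ≡ lookup xs j → i ≡ j
  lookup-injective (_ ∷ _)  {fzero}  {fzero}  _  = refl
  lookup-injective (x∉ ∷ _) {fzero}  {fsuc j} eq = ⊥-elim (All.lookup x∉ (∈-lookup j) eq)
  lookup-injective (x∉ ∷ _) {fsuc i} {fzero}  eq = ⊥-elim (All.lookup x∉ (∈-lookup i) (sym eq))
  lookup-injective (_ ∷ u)  {fsuc i} {fsuc j} eq with lookup-injective u eq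
  ... | refl = refl

  path-steps< : (w : DPath E x y) → steps (proj₁ w) < n
  path-steps< (w , w-unique) =
    subst (_≤ n) (length-verts w) (injective⇒≤ (lookup-injective w-unique))

  shortWalk? : (E : Digraph n) (k : ℕ) (x y : Fin n) →
    Dec (Σ (Walk E x y) λ w → steps w ≤ k)
  shortWalk? E k x y with x ≟ y
  ... | yes refl = yes (stop x , z≤n)
  shortWalk? E zero x y | no x≢y =
    no λ { (stop _ , _) → x≢y refl ; (step _ _ , ()) }
  shortWalk? E (suc k) x y | no x≢y
    with any? (λ z → (E x z ≟ᵇ true) ×-dec shortWalk? E k z y)
  ... | yes (z , e , w , w≤k) = yes (step e w , s≤s w≤k)
  ... | no ∄z = no λ { (stop _ , _) → x≢y refl
                     ; (step e w , s≤s w≤k) → ∄z (_ , e , w , w≤k) }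

  -- Reachability is decidable: if y is reachable from x, it is so by a path,
  -- which has at most n arcs.
  walk? : (E : Digraph n) (x y : Fin n) → Dec (Walk E x y)
  walk? E x y with shortWalk? E n x y
  ... | yes (w , _) = yes w
  ... | no ∄short   = no λ w → ∄short (proj₁ (shorten w) , <⇒≤ (path-steps< (shorten w)))

  dpath? : (E : Digraph n) (x y : Fin n) → Dec (DPath E x y)
  dpath? E x y = map′ shorten proj₁ (walk? E x y)

  NotArc : Fin n → Fin n → Fin n → Fin n → Set
  NotArc a b p q = ¬ (p ≡ a × q ≡ b)

  AllArcs : (Fin n → Fin n → Set) → Walk E x y → Set
  AllArcs Q (stop _)           = ⊤
  AllArcs Q (step {x} {y} _ w) = Q x y × AllArcs Q w

  mapArcs : {Q Q′ : Fin n → Fin n → Set} → (∀ {p q} → Q p q → Q′ p q) →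
    (w : Walk E x y) → AllArcs Q w → AllArcs Q′ w
  mapArcs f (stop _)   _        = tt
  mapArcs f (step _ w) (q , qs) = f q , mapArcs f w qs

  removeArc-keeps : E p q ≡ true → NotArc a b p q → removeArc E a b p q ≡ true
  removeArc-keeps {p = p} {q} {a} {b} e pq≢ab with p ≟ a | q ≟ b
  ... | yes p≡a | yes q≡b = ⊥-elim (pq≢ab (p≡a , q≡b))
  ... | yes _   | no _    = e
  ... | no _    | _       = e

  liftWalk : (w : Walk E x y) → AllArcs (NotArc a b) w → Walk (removeArc E a b) x y
  liftWalk          (stop x)   _          = stop x
  liftWalk {E = E} (step e w) (ok , oks) = step (removeArc-keeps {E = E} e ok) (liftWalk w oks)

  leavesNot : (w : Walk E x y) → All (a ≢_) (vertsButLast w) → AllArcs (NotArc a b) w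
  leavesNot (stop _)   _           = tt
  leavesNot (step _ w) (a≢x ∷ a≢s) = (λ (x≡a , _) → a≢x (sym x≡a)) , leavesNot w a≢s

  avoids : (w : Walk E x y) → a ∉ verts w → AllArcs (NotArc a b) w
  avoids w a∉w = leavesNot w (All-vertsButLast w (¬Any⇒All¬ (verts w) a∉w))

  splitAtArc : (w : Walk E x y) → Unique (verts w) → ¬ Walk (removeArc E a b) x y →
    Walk (removeArc E a b) x a × Σ (Walk E b y) λ w′ → Unique (a ∷ verts w′)
  splitAtArc (stop x) _ broken = ⊥-elim (broken (stop x))
  splitAtArc {E = E} {a = a} {b} (step {x} {y} e w) (x∉w ∷ w-unique) broken with x ≟ a
  ... | yes refl with y ≟ b
  ...   | yes refl = stop x , w , (x∉w ∷ w-unique)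
  ...   | no  y≢b  = ⊥-elim (broken (step (removeArc-keeps {E = E} e (λ (_ , y≡b) → y≢b y≡b))
                                         (liftWalk w (avoids w (All¬⇒¬Any x∉w)))))
  splitAtArc {E = E} (step e w) (_ ∷ w-unique) broken | no x≢a =
    let e′          = removeArc-keeps {E = E} e (λ (x≡a , _) → x≢a x≡a)
        (toA , rest) = splitAtArc w w-unique (λ w′ → broken (step e′ w′))
    in step e′ toA , rest

  brokenRequirement : {H R : Digraph n} → MinimalSolution H R → H a b ≡ true →
    ∃[ x ] ∃[ y ] R x y ≡ true × ¬ Walk (removeArc H a b) x y
  brokenRequirement {a = a} {b} {H} {R} (_ , minimal) ab∈H =
    pick (¬∀⟶∃¬ n _ (λ x → all? (satisfied? x)) (minimal a b ab∈H))
    where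
    Satisfied : Fin n → Fin n → Set
    Satisfied x y = R x y ≡ true → DPath (removeArc H a b) x y

    satisfied? : ∀ x y → Dec (Satisfied x y)
    satisfied? x y = (R x y ≟ᵇ true) →-dec dpath? _ x y

    unsatisfied : ∀ {x y} → ¬ Satisfied x y → R x y ≡ true × ¬ Walk (removeArc H a b) x y
    unsatisfied {x} {y} ¬sat with R x y ≟ᵇ true
    ... | yes xy∈R = xy∈R , λ w → ¬sat (λ _ → shorten w)
    ... | no  xy∉R = ⊥-elim (¬sat (λ xy∈R → ⊥-elim (xy∉R xy∈R)))

    pick : ∃[ x ] ¬ (∀ y → Satisfied x y) →
      ∃[ x ] ∃[ y ] R x y ≡ true × ¬ Walk (removeArc H a b) x y
    pick (x , ¬∀y) with ¬∀⟶∃¬ n _ (satisfied? x) ¬∀y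
    ... | y , ¬sat = x , y , unsatisfied ¬sat

  data Consec : List (Fin n) → Fin n → Fin n → Set where
    here  : ∀ {l} → Consec (a ∷ b ∷ l) a b
    there : ∀ {c l} → Consec l a b → Consec (c ∷ l) a b

  consec-fst : ∀ {l} → Consec l a b → a ∈ l
  consec-fst here      = here refl
  consec-fst (there c) = there (consec-fst c)

  consec-snd : ∀ {l} → Consec l a b → b ∈ l
  consec-snd here      = there (here refl)
  consec-snd (there c) = there (consec-snd c)

  consec-functional : ∀ {l c} → Unique l → Consec l a b → Consec l a c → b ≡ c
  consec-functional _        here      here       = refl
  consec-functional (a∉ ∷ _) here      (there c)  = ⊥-elim (All.lookup a∉ (consec-fst c) refl)
  consec-functional (a∉ ∷ _) (there c) here       = ⊥-elim (All.lookup a∉ (consec-fst c) refl)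
  consec-functional (_ ∷ u)  (there c) (there c′) = consec-functional u c c′

  consec? : ∀ l a b → Dec (Consec l a b)
  consec? []          a b = no λ ()
  consec? (x ∷ [])    a b = no λ { (there ()) }
  consec? (x ∷ y ∷ l) a b with consec? (y ∷ l) a b
  ... | yes c = yes (there c)
  ... | no ¬c with x ≟ a | y ≟ b
  ...   | yes refl | yes refl = yes here
  ...   | no x≢a   | _        = no λ { here → x≢a refl ; (there c) → ¬c c }
  ...   | yes _    | no y≢b   = no λ { here → y≢b refl ; (there c) → ¬c c }

  Segment : Digraph n → List (Fin n) → Fin n → Fin n → Set
  Segment E l x y = Σ (Walk E x y) (AllArcs (Consec l))

  consec-first : (w : Walk E y z) → Consec (x ∷ verts w) x y
  consec-first (stop _)   = here
  consec-first (step _ _) = here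

  prefixTo : (P : Walk E s t) → y ∈ verts P → Segment E (verts P) s y
  prefixTo (stop _)    (here refl) = stop _ , tt
  prefixTo (step e P)  (here refl) = stop _ , tt
  prefixTo (step e P)  (there y∈P) with prefixTo P y∈P
  ... | w , arcs = step e w , consec-first P , mapArcs there w arcs

  compareOn : (P : Walk E s t) → x ∈ verts P → y ∈ verts P →
    (Before (verts P) y x × Segment E (verts P) y x) ⊎ Segment E (verts P) x y
  compareOn (stop _)   (here refl) (here refl) = inj₂ (stop _ , tt)
  compareOn (step e P) (here refl) (here refl) = inj₂ (stop _ , tt)
  compareOn (step e P) (here refl) (there y∈P) = inj₂ (prefixTo (step e P) (there y∈P))
  compareOn (step e P) (there x∈P) (here refl) =
    inj₁ ((fzero , fsuc (index x∈P) , s≤s z≤n , refl , sym (lookup-index x∈P))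
         , prefixTo (step e P) (there x∈P))
  compareOn (step e P) (there x∈P) (there y∈P) with compareOn P x∈P y∈P
  ... | inj₁ ((i , j , i<j , eqᵢ , eqⱼ) , w , arcs) =
        inj₁ ((fsuc i , fsuc j , s≤s i<j , eqᵢ , eqⱼ) , w , mapArcs there w arcs)
  ... | inj₂ (w , arcs) = inj₂ (w , mapArcs there w arcs)

  record FirstEntry (L : List (Fin n)) (w : Walk E x y) : Set where
    field
      entry     : Fin n
      entry∈L   : entry ∈ L
      enter     : Walk E x entry
      enter-off : All (_∉ L) (vertsButLast enter)
      leave     : Walk E entry y
      enter⊆    : verts enter ⊆ verts w
      leave⊆    : verts leave ⊆ verts w
      enter-unique : Unique (verts w) → Unique (verts enter)

  firstEntry : (L : List (Fin n)) (w : Walk E x y) → All (_∉ L) (verts w) ⊎ FirstEntry L w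
  firstEntry L (stop x) with x ∈? L
  ... | yes x∈L = inj₂ (record { entry = x ; entry∈L = x∈L ; enter = stop x ; enter-off = []
                               ; leave = stop x ; enter⊆ = λ m → m ; leave⊆ = λ m → m
                               ; enter-unique = λ _ → [] ∷ [] })
  ... | no  x∉L = inj₁ (x∉L ∷ [])
  firstEntry L (step {x} e w′) with x ∈? L
  ... | yes x∈L = inj₂ (record { entry = x ; entry∈L = x∈L ; enter = stop x ; enter-off = []
                               ; leave = step e w′ ; enter⊆ = λ { (here refl) → here refl }
                               ; leave⊆ = λ m → m ; enter-unique = λ _ → [] ∷ [] })
  ... | no  x∉L with firstEntry L w′
  ...   | inj₁ off = inj₁ (x∉L ∷ off)
  ...   | inj₂ h = inj₂ (record
          { entry = entry ; entry∈L = entry∈L ; enter = step e enter ; enter-off = x∉L ∷ enter-off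
          ; leave = leave
          ; enter⊆ = λ { (here refl) → here refl ; (there m) → there (enter⊆ m) }
          ; leave⊆ = λ m → there (leave⊆ m)
          ; enter-unique = λ { (x∉w′ ∷ u) →
              All.tabulate (λ m → All.lookup x∉w′ (enter⊆ m)) ∷ enter-unique u } })
          where open FirstEntry h

atMostTwo : ∀ {X : Set} {A B : X → Set} →
  (∀ {x y} → A x → A y → x ≡ y) → (∀ {x y} → B x → B y → x ≡ y) →
  ∀ {xs} → Unique xs → All (λ x → A x ⊎ B x) xs → length xs ≤ 2
atMostTwo oneA oneB {[]}         _ _ = z≤n
atMostTwo oneA oneB {_ ∷ []}     _ _ = s≤s z≤n
atMostTwo oneA oneB {_ ∷ _ ∷ []} _ _ = s≤s (s≤s z≤n)
atMostTwo {A = A} {B} oneA oneB {x ∷ y ∷ z ∷ _} ((x≢y ∷ x≢z ∷ _) ∷ (y≢z ∷ _) ∷ _) (cx ∷ cy ∷ cz ∷ _)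
  = ⊥-elim (collide cx cy cz)
  where
  collide : A x ⊎ B x → A y ⊎ B y → A z ⊎ B z → ⊥
  collide (inj₁ ax) (inj₁ ay) _         = x≢y (oneA ax ay)
  collide (inj₂ bx) (inj₂ by) _         = x≢y (oneB bx by)
  collide (inj₁ ax) (inj₂ _)  (inj₁ az) = x≢z (oneA ax az)
  collide (inj₁ _)  (inj₂ by) (inj₂ bz) = y≢z (oneB by bz)
  collide (inj₂ _)  (inj₁ ay) (inj₁ az) = y≢z (oneA ay az)
  collide (inj₂ bx) (inj₁ _)  (inj₂ bz) = x≢z (oneB bx bz)

module NonImportant {n : ℕ} (H R : Digraph n) (Term : VSet n)
  (requirementsTerminal : ∀ x y → R x y ≡ true → Term x ≡ true × Term y ≡ true)
  (minimal : MinimalSolution H R)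
  {s t : Fin n} (P : Walk H s t) (P-path : IsPath P)
  (v : Fin n) (v∈P : v ∈ verts P) (v-unimportant : ¬ Important H Term P v) where

  private variable
    u u′ x y : Fin n

  Succ : Fin n → Set
  Succ u = Consec (verts P) v u

  alongP : ¬ Succ u → (w : Walk H x y) → AllArcs (Consec (verts P)) w →
    AllArcs (NotArc v u) w
  alongP ¬succ = mapArcs (λ { c (refl , refl) → ¬succ c })

  escape⇒important : ∀ {b} → H v u ≡ true → (post : Walk H u b) → Unique (v ∷ verts post) →
    Term b ≡ true → All (_∉ verts P) (verts post) → Important H Term P v
  escape⇒important vu∈H post path Tb off =
    v∈P , _ , Tb , All.lookup off (last∈ post) ,
    inj₂ ((step vu∈H post , path) , All-vertsButLast post off)

  record ReEntry (u : Fin n) : Set where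
    field
      a b       : Fin n
      broken    : ¬ Walk (removeArc H v u) a b
      toV       : Walk (removeArc H v u) a v
      reentry   : Fin n
      reentry∈P : reentry ∈ verts P
      out       : Walk H u reentry
      out-path  : Unique (verts out)
      out-off   : All (_∉ verts P) (inner out)
      v∉out     : v ∉ verts out
      back      : Walk H reentry b
      v∉back    : v ∉ verts back

  -- By minimality and since v is not important, every out-neighbour u has
  -- such data.
  reEntry : H v u ≡ true → ReEntry u
  reEntry vu∈H with brokenRequirement minimal vu∈H
  ... | a , b , ab∈R , broken with proj₁ minimal a b ab∈R
  ... | Q , Q-path with splitAtArc Q Q-path broken
  ... | toV , post , post-path@(v∉post ∷ post-unique) with firstEntry (verts P) post
  ... | inj₁ off = ⊥-elim (v-unimportant (escape⇒important vu∈H post post-path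
                                           (proj₂ (requirementsTerminal a b ab∈R)) off))
  ... | inj₂ e = let open FirstEntry e in record
    { a = a ; b = b ; broken = broken ; toV = toV
    ; reentry = entry ; reentry∈P = entry∈L
    ; out = enter ; out-path = enter-unique post-unique
    ; out-off = All-inner enter enter-off
    ; v∉out = λ m → All.lookup v∉post (enter⊆ m) refl
    ; back = leave ; v∉back = λ m → All.lookup v∉post (leave⊆ m) refl }

  -- A walk from v to the re-entry point avoiding v u would repair the
  -- broken requirement.
  cannotReach : (D : ReEntry u) → ¬ Walk (removeArc H v u) v (ReEntry.reentry D)
  cannotReach D w = broken (toV ++ʷ w ++ʷ liftWalk back (avoids back v∉back))
    where open ReEntry D

  -- Unless u is the successor of v, the re-entry lies strictly before v:
  -- otherwise P itself leads from v to it.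
  reentry-before : ¬ Succ u → (D : ReEntry u) → Before (verts P) (ReEntry.reentry D) v
  reentry-before ¬succ D with compareOn P v∈P (ReEntry.reentry∈P D)
  ... | inj₁ (before , _) = before
  ... | inj₂ (seg , arcs) = ⊥-elim (cannotReach D (liftWalk seg (alongP ¬succ seg arcs)))

  -- With re-entries z′ before z, the requirement broken for u is repaired
  -- by v → u′ ⇝ z′ ⇝ z, the last part along P.
  reroute : u ≢ u′ → ¬ Succ u → H v u′ ≡ true → (D : ReEntry u) (D′ : ReEntry u′) →
    Segment H (verts P) (ReEntry.reentry D′) (ReEntry.reentry D) → ⊥
  reroute u≢u′ ¬succ vu′∈H D D′ (seg , arcs) =
    cannotReach D (step (removeArc-keeps {E = H} vu′∈H (λ (_ , u′≡u) → u≢u′ (sym u′≡u)))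
      (liftWalk out′ (avoids out′ v∉out′) ++ʷ liftWalk seg (alongP ¬succ seg arcs)))
    where open ReEntry D′ renaming (out to out′; v∉out to v∉out′)

  Detour : Fin n → Set
  Detour u = H v u ≡ true × ¬ Succ u

  detour-unique : Detour u → Detour u′ → u ≡ u′
  detour-unique {u} {u′} (vu∈H , ¬succ) (vu′∈H , ¬succ′) with u ≟ u′
  ... | yes u≡u′ = u≡u′
  ... | no  u≢u′ with reEntry vu∈H | reEntry vu′∈H
  ...   | D | D′ with compareOn P (ReEntry.reentry∈P D) (ReEntry.reentry∈P D′)
  ...     | inj₁ (_ , seg) = ⊥-elim (reroute u≢u′ ¬succ vu′∈H D D′ seg)
  ...     | inj₂ seg       = ⊥-elim (reroute (λ u′≡u → u≢u′ (sym u′≡u)) ¬succ′ vu∈H D′ D seg)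

  -- Each out-neighbour is the successor or a detour neighbour; each kind
  -- occurs at most once.
  outdeg≤2 : outdeg H v ≤ 2
  outdeg≤2 = atMostTwo (consec-functional P-path) detour-unique
    (filter⁺ (λ u → T? (H v u)) (allFin⁺ n))
    (All.map classify (all-filter (λ u → T? (H v u)) (allFin n)))
    where
    classify : ∀ {u} → T (H v u) → Succ u ⊎ Detour u
    classify {u} vu∈H with consec? (verts P) v u
    ... | yes succ = inj₁ succ
    ... | no ¬succ = inj₂ (Equivalence.to T-≡ vu∈H , ¬succ)

  -- An out-neighbour off P is a detour neighbour; its continuation re-enters
  -- P strictly before v.
  offPath-returns : ∀ u → H v u ≡ true → u ∉ verts P →
    ∃[ v′ ] (Σ (DPath H u v′) λ Q → Avoiding (verts P) (proj₁ Q) × Before (verts P) v′ v)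
  offPath-returns u vu∈H u∉P =
    reentry , (out , out-path) , out-off , reentry-before (λ succ → u∉P (consec-snd succ)) D
    where
    D : ReEntry u
    D = reEntry vu∈H
    open ReEntry D

mainTheorem5 : {n : ℕ} (H R : Digraph n) (Term : VSet n) →
    (∀ x y → R x y ≡ true → Term x ≡ true × Term y ≡ true) →
    MinimalSolution H R →
    (s t : Fin n) → Term s ≡ true → Term t ≡ true →
    (P : Walk H s t) → IsPath P → All (λ x → Term x ≡ false) (inner P) →
    (v : Fin n) → v ∈ verts P → ¬ Important H Term P v →
    (outdeg H v ≤ 2)
    × (∀ u → H v u ≡ true → u ∉ verts P →
         ∃[ v′ ] (Σ (DPath H u v′) λ Q →
           Avoiding (verts P) (proj₁ Q) × Before (verts P) v′ v))
mainTheorem5 H R Term requirementsTerminal minimal s t _ _ P P-path _ v v∈P v-unimportant =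
  outdeg≤2 , offPath-returns
  where open NonImportant H R Term requirementsTerminal minimal P P-path v v∈P v-unimportant
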